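{- The computation type $T\omega_{\mathsf V}$ is non trivial (i.e. $T\omega_{\mathsf V}\neq_{\mathsf C}\omega_{\mathsf C}$), and for every computation type $\tau$: $\tau$ is non trivial if and only if $\tau\le_{\mathsf C}T\omega_{\mathsf V}$.
   Context: Value types $\delta ::= \alpha\mid \delta\to\tau\mid \delta\wedge\delta\mid \omega_{\mathsf V}$ ($\alpha$ type variables), computation types $\tau ::= T\delta\mid \tau\wedge\tau\mid \omega_{\mathsf C}$. The preorders $\le_{\mathsf V},\le_{\mathsf C}$ are the least preorders such that for each sort $\omega$ is top, $\wedge$ is monotone, idempotent, commutative, $\sigma\wedge\sigma'\le\sigma$, $\sigma\le\sigma',\sigma\le\sigma''\Rightarrow\sigma\le\sigma'\wedge\sigma''$, and $\omega_{\mathsf V}\le_{\mathsf V}\omega_{\mathsf V}\to\omega_{\mathsf C}$, $(\delta\to\tau)\wedge(\delta\to\tau')\le_{\mathsf V}\delta\to(\tau\wedge\tau')$, $\delta'\le_{\mathsf V}\delta,\tau\le_{\mathsf C}\tau'\Rightarrow\delta\to\tau\le_{\mathsf V}\delta'\to\tau'$, $T\delta\wedge T\delta'\le_{\mathsf C}T(\delta\wedge\delta')$, $\delta\le_{\mathsf V}\delta'\Rightarrow T\delta\le_{\mathsf C}T\delta'$. $\tau=_{\mathsf C}\tau'$ means $\tau\le_{\mathsf C}\tau'$ and $\tau'\le_{\mathsf C}\tau$; $\tau$ is non trivial if $\tau\neq_{\mathsf C}\omega_{\mathsf C}$. -}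

module Defs where

open import Data.Nat using (ℕ)
open import Data.Product using (_×_)
open import Relation.Nullary using (¬_)

mutual
  data VTy : Set where
    var  : ℕ → VTy
    _⇒_  : VTy → CTy → VTy
    _∧V_ : VTy → VTy → VTy
    ωV   : VTy

  data CTy : Set where
    T    : VTy → CTy
    _∧C_ : CTy → CTy → CTy
    ωC   : CTy

infixr 5 _⇒_
infixl 6 _∧V_ _∧C_

mutual
  data _≤V_ : VTy → VTy → Set where
    refl≤  : ∀ {δ} → δ ≤V δ
    trans≤ : ∀ {δ δ' δ''} → δ ≤V δ' → δ' ≤V δ'' → δ ≤V δ''
    top    : ∀ {δ} → δ ≤V ωV
    ∧-mono : ∀ {a a' b b'} → a ≤V a' → b ≤V b' → (a ∧V b) ≤V (a' ∧V b')
    ∧-idem : ∀ {a} → a ≤V (a ∧V a)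
    ∧-idem' : ∀ {a} → (a ∧V a) ≤V a
    ∧-comm : ∀ {a b} → (a ∧V b) ≤V (b ∧V a)
    ∧-lb   : ∀ {a b} → (a ∧V b) ≤V a
    ∧-glb  : ∀ {a b c} → a ≤V b → a ≤V c → a ≤V (b ∧V c)
    ω⇒     : ωV ≤V (ωV ⇒ ωC)
    ⇒-∧    : ∀ {δ τ τ'} → ((δ ⇒ τ) ∧V (δ ⇒ τ')) ≤V (δ ⇒ (τ ∧C τ'))
    ⇒-mono : ∀ {δ δ' τ τ'} → δ' ≤V δ → τ ≤C τ' → (δ ⇒ τ) ≤V (δ' ⇒ τ')

  data _≤C_ : CTy → CTy → Set where
    refl≤  : ∀ {τ} → τ ≤C τ
    trans≤ : ∀ {τ τ' τ''} → τ ≤C τ' → τ' ≤C τ'' → τ ≤C τ''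
    top    : ∀ {τ} → τ ≤C ωC
    ∧-mono : ∀ {a a' b b'} → a ≤C a' → b ≤C b' → (a ∧C b) ≤C (a' ∧C b')
    ∧-idem : ∀ {a} → a ≤C (a ∧C a)
    ∧-idem' : ∀ {a} → (a ∧C a) ≤C a
    ∧-comm : ∀ {a b} → (a ∧C b) ≤C (b ∧C a)
    ∧-lb   : ∀ {a b} → (a ∧C b) ≤C a
    ∧-glb  : ∀ {a b c} → a ≤C b → a ≤C c → a ≤C (b ∧C c)
    T-∧    : ∀ {δ δ'} → (T δ ∧C T δ') ≤C T (δ ∧V δ')
    T-mono : ∀ {δ δ'} → δ ≤V δ' → T δ ≤C T δ'

infix 4 _≤V_ _≤C_ _=C_

_=C_ : CTy → CTy → Set
τ =C τ' = (τ ≤C τ') × (τ' ≤C τ)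

NonTrivial : CTy → Set
NonTrivial τ = ¬ (τ =C ωC)

module Submission where

open import Defs
open import Data.Product using (_×_; _,_)
open import Data.Sum using (_⊎_; inj₁; inj₂)
open import Data.Unit using (⊤; tt)
open import Data.Empty using (⊥; ⊥-elim)
open import Function.Bundles using (_⇔_; mk⇔)

-- A computation type is non trivial exactly when one of its conjuncts has the
-- form T δ. This property is reflected by ≤C (each generating rule preserves
-- it from right to left) and fails for ωC, so no T δ lies below ωC. Conversely,
-- a type with a conjunct T δ lies below T δ ≤C T ωV, and a type without one is
-- a conjunction of copies of ωC, hence equal to ωC.

HasT : CTy → Set
HasT (T _)    = ⊤
HasT (a ∧C b) = HasT a ⊎ HasT b
HasT ωC       = ⊥

HasT-reflect : ∀ {a b} → a ≤C b → HasT b → HasT a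
HasT-reflect refl≤           h        = h
HasT-reflect (trans≤ a≤b b≤c) h       = HasT-reflect a≤b (HasT-reflect b≤c h)
HasT-reflect top             ()
HasT-reflect (∧-mono a≤ b≤)  (inj₁ h) = inj₁ (HasT-reflect a≤ h)
HasT-reflect (∧-mono a≤ b≤)  (inj₂ h) = inj₂ (HasT-reflect b≤ h)
HasT-reflect ∧-idem          (inj₁ h) = h
HasT-reflect ∧-idem          (inj₂ h) = h
HasT-reflect ∧-idem'         h        = inj₁ h
HasT-reflect ∧-comm          (inj₁ h) = inj₂ h
HasT-reflect ∧-comm          (inj₂ h) = inj₁ h
HasT-reflect ∧-lb            h        = inj₁ h
HasT-reflect (∧-glb a≤b a≤c) (inj₁ h) = HasT-reflect a≤b h
HasT-reflect (∧-glb a≤b a≤c) (inj₂ h) = HasT-reflect a≤c h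
HasT-reflect T-∧             _        = inj₁ tt
HasT-reflect (T-mono _)      _        = tt

HasT⇒nonTrivial : ∀ {τ} → HasT τ → NonTrivial τ
HasT⇒nonTrivial h (_ , ωC≤τ) = HasT-reflect ωC≤τ h

HasT⇒≤TωV : ∀ τ → HasT τ → τ ≤C T ωV
HasT⇒≤TωV (T _)    _        = T-mono top
HasT⇒≤TωV (a ∧C b) (inj₁ h) = trans≤ ∧-lb (HasT⇒≤TωV a h)
HasT⇒≤TωV (a ∧C b) (inj₂ h) = trans≤ ∧-comm (trans≤ ∧-lb (HasT⇒≤TωV b h))

HasT-or-trivial : ∀ τ → HasT τ ⊎ ωC ≤C τ
HasT-or-trivial (T _)    = inj₁ tt
HasT-or-trivial (a ∧C b) with HasT-or-trivial a | HasT-or-trivial b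
... | inj₁ h    | _         = inj₁ (inj₁ h)
... | inj₂ _    | inj₁ h    = inj₁ (inj₂ h)
... | inj₂ ω≤a  | inj₂ ω≤b  = inj₂ (∧-glb ω≤a ω≤b)
HasT-or-trivial ωC       = inj₂ refl≤

nonTrivial⇒≤TωV : ∀ τ → NonTrivial τ → τ ≤C T ωV
nonTrivial⇒≤TωV τ nt with HasT-or-trivial τ
... | inj₁ h    = HasT⇒≤TωV τ h
... | inj₂ ω≤τ  = ⊥-elim (nt (top , ω≤τ))

T-nonTrivial : ∀ δ → NonTrivial (T δ)
T-nonTrivial δ = HasT⇒nonTrivial tt

nonTrivial-antitone : ∀ {τ τ'} → τ ≤C τ' → NonTrivial τ' → NonTrivial τ
nonTrivial-antitone τ≤τ' nt' (_ , ω≤τ) = nt' (top , trans≤ ω≤τ τ≤τ')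

mainTheorem13 : NonTrivial (T ωV) × ((τ : CTy) → NonTrivial τ ⇔ (τ ≤C T ωV))
mainTheorem13 =
  T-nonTrivial ωV ,
  λ τ → mk⇔ (nonTrivial⇒≤TωV τ)
            (λ τ≤TωV → nonTrivial-antitone τ≤TωV (T-nonTrivial ωV))
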